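{- Let $G=(V,E)$ be a connected graph with shortest-path distance $d$ and let $f:V\to\mathbb{Z}$. For every two sets of nodes $S,U\subseteq V$, \[ \sum_{v\in U}\varphi(v)\ \ge\ |S\setminus M(U)|. \]
   Context: The implied-error function is $\varphi(v)=|\{u\in V\mid d(u,v)\neq f(u)\}|$ for $v\in V$. For a set $U\subseteq V$, its midpoint set $M(U)$ is the set of nodes $w\in V$ whose distance to all points of $U$ is the same, i.e., $d(w,u)=d(w,u')$ for all $u,u'\in U$. -}

module Defs where

open import Data.Nat using (ℕ; zero; suc; _≤_; _+_)
open import Data.Integer as ℤ using (ℤ; +_)
open import Data.Fin using (Fin)
open import Data.Fin.Subset using (Subset; _∈_; _─_; ∣_∣)
open import Data.Fin.Subset.Properties using (_∈?_)
open import Data.Fin.Properties using (all?)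
open import Data.Vec using (tabulate)
open import Data.List using (List; map; allFin)
open import Data.Nat.ListAction using (sum)
open import Data.Bool using (if_then_else_; not)
open import Data.Product using (_×_; ∃)
open import Relation.Nullary using (¬_; Dec; does; _→-dec_)
open import Relation.Binary.PropositionalEquality using (_≡_)
open import Data.Nat.Properties using (_≟_)

record Graph (n : ℕ) : Set₁ where
  field
    Adj   : Fin n → Fin n → Set
    sym   : ∀ {u v} → Adj u v → Adj v u
    irrefl : ∀ {u} → ¬ Adj u u
open Graph public

data Walk {n : ℕ} (G : Graph n) : Fin n → Fin n → ℕ → Set where
  [] : ∀ {u} → Walk G u u zero
  _∷_ : ∀ {u w v k} → Adj G u w → Walk G w v k → Walk G u v (suc k)

Connected : ∀ {n} → Graph n → Set
Connected G = ∀ u v → ∃ λ k → Walk G u v k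

IsShortestPathDistance : ∀ {n} → Graph n → (Fin n → Fin n → ℕ) → Set
IsShortestPathDistance G d =
  ∀ u v → Walk G u v (d u v) × (∀ k → Walk G u v k → d u v ≤ k)

module _ {n : ℕ} (d : Fin n → Fin n → ℕ) where

  φ : (Fin n → ℤ) → Fin n → ℕ
  φ f v = ∣ tabulate (λ u → not (does ((+ d u v) ℤ.≟ f u))) ∣

  IsMidpoint : Subset n → Fin n → Set
  IsMidpoint U w = ∀ u → u ∈ U → ∀ u' → u' ∈ U → d w u ≡ d w u'

  isMidpoint? : ∀ U w → Dec (IsMidpoint U w)
  isMidpoint? U w = all? λ u → (u ∈? U) →-dec all? λ u' → (u' ∈? U) →-dec (d w u ≟ d w u')

  M : Subset n → Subset n
  M U = tabulate λ w → does (isMidpoint? U w)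

  sumOver : Subset n → (Fin n → ℕ) → ℕ
  sumOver U g = sum (map (λ v → if does (v ∈? U) then g v else 0) (allFin n))

{-# OPTIONS --safe #-}
-- Double counting: Σ_{v∈U} φ(v) counts the pairs (s, v) with v ∈ U and
-- d(s,v) ≠ f(s). A node s with no such pair has d(s,v) = f(s) for every
-- v ∈ U, so it is a midpoint of U; hence every s ∉ M(U), in particular
-- every s ∈ S ∖ M(U), contributes at least one pair.
module Submission where

open import Defs hiding (sym)
import Algebra.Properties.CommutativeMonoid.Sum as CommutativeMonoidSum
open import Data.Bool using (Bool; true; false; if_then_else_; not)
open import Data.Fin using (Fin; zero; suc)
open import Data.Fin.Subset using (Subset; _∈_; _⊆_; _─_; ∁; ∣_∣; inside; outside)
open import Data.Fin.Subset.Properties using (_∈?_; p⊆q⇒∣p∣≤∣q∣)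
open import Data.Integer using (ℤ; +_; _≟_)
open import Data.Integer.Properties using (+-injective)
import Data.List as List using (tabulate; map; allFin)
import Data.List.Properties as List using (map-tabulate)
import Data.Nat.ListAction as List using (sum)
open import Data.Nat using (ℕ; zero; suc; _+_; _≤_; _≥_; z≤n; s≤s)
open import Data.Nat.Properties using (+-0-commutativeMonoid; +-mono-≤; m+n≡0⇒m≡0; m+n≡0⇒n≡0; module ≤-Reasoning)
open import Data.Vec using (_∷_; tabulate; here; there)
open import Data.Vec.Properties using (tabulate-∘)
open import Function using (_∘_)
open import Relation.Nullary using (Dec; yes; no; does; contradiction)
open import Relation.Binary.PropositionalEquality using (_≡_; refl; sym; trans; cong; module ≡-Reasoning)

open CommutativeMonoidSum +-0-commutativeMonoid using (sum-syntax; ∑-comm; sum-cong-≗; sum-replicate-zero)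

𝟙 : Bool → ℕ
𝟙 true  = 1
𝟙 false = 0

𝟙-not-does≤ : ∀ {p} {P : Set p} (P? : Dec P) {m : ℕ} → (m ≡ 0 → P) → 𝟙 (not (does P?)) ≤ m
𝟙-not-does≤ (yes _)          _      = z≤n
𝟙-not-does≤ (no ¬p) {zero}   m≡0⇒p = contradiction (m≡0⇒p refl) ¬p
𝟙-not-does≤ (no _)  {suc _}  _      = s≤s z≤n

𝟙-not-does≡0⇒ : ∀ {p} {P : Set p} (P? : Dec P) → 𝟙 (not (does P?)) ≡ 0 → P
𝟙-not-does≡0⇒ (yes p) _ = p

∑-mono-≤ : ∀ {n} {g h : Fin n → ℕ} → (∀ i → g i ≤ h i) → ∑[ i < n ] g i ≤ ∑[ i < n ] h i
∑-mono-≤ {zero}  _   = z≤n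
∑-mono-≤ {suc n} g≤h = +-mono-≤ (g≤h zero) (∑-mono-≤ (g≤h ∘ suc))

∑≡0⇒≡0 : ∀ {n} (g : Fin n → ℕ) → ∑[ i < n ] g i ≡ 0 → ∀ i → g i ≡ 0
∑≡0⇒≡0 g ∑≡0 zero    = m+n≡0⇒m≡0 (g zero) ∑≡0
∑≡0⇒≡0 g ∑≡0 (suc i) = ∑≡0⇒≡0 (g ∘ suc) (m+n≡0⇒n≡0 (g zero) ∑≡0) i

sum-tabulate : ∀ {n} (g : Fin n → ℕ) → List.sum (List.tabulate g) ≡ ∑[ i < n ] g i
sum-tabulate {zero}  g = refl
sum-tabulate {suc n} g = cong (_+_ (g zero)) (sum-tabulate (g ∘ suc))

sum-map-allFin : ∀ {n} (g : Fin n → ℕ) → List.sum (List.map g (List.allFin n)) ≡ ∑[ i < n ] g i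
sum-map-allFin g = trans (cong List.sum (List.map-tabulate (λ i → i) g)) (sum-tabulate g)

∣tabulate∣≡∑ : ∀ {n} (e : Fin n → Bool) → ∣ tabulate e ∣ ≡ ∑[ i < n ] 𝟙 (e i)
∣tabulate∣≡∑ {zero}  e = refl
∣tabulate∣≡∑ {suc n} e with e zero
... | true  = cong suc (∣tabulate∣≡∑ (e ∘ suc))
... | false = ∣tabulate∣≡∑ (e ∘ suc)

p─q⊆∁q : ∀ {n} (p q : Subset n) → p ─ q ⊆ ∁ q
p─q⊆∁q (_ ∷ p) (outside ∷ q) here      = here
p─q⊆∁q (_ ∷ p) (_       ∷ q) (there x) = there (p─q⊆∁q p q x)

∣p─q∣≤∣∁q∣ : ∀ {n} (p q : Subset n) → ∣ p ─ q ∣ ≤ ∣ ∁ q ∣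
∣p─q∣≤∣∁q∣ p q = p⊆q⇒∣p∣≤∣q∣ (p─q⊆∁q p q)

∣∁tabulate∣≡∑ : ∀ {n} (e : Fin n → Bool) → ∣ ∁ (tabulate e) ∣ ≡ ∑[ i < n ] 𝟙 (not (e i))
∣∁tabulate∣≡∑ e = trans (cong ∣_∣ (sym (tabulate-∘ not e))) (∣tabulate∣≡∑ (not ∘ e))

restrict : ∀ {n} → Subset n → (Fin n → ℕ) → Fin n → ℕ
restrict U g v = if does (v ∈? U) then g v else 0

restrict≡0⇒ : ∀ {n} (U : Subset n) (g : Fin n → ℕ) {v} → restrict U g v ≡ 0 → v ∈ U → g v ≡ 0
restrict≡0⇒ U g {v} r≡0 v∈U with v ∈? U
... | yes _   = r≡0
... | no v∉U = contradiction v∈U v∉U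

restrict-∑ : ∀ {m n} (U : Subset n) (h : Fin m → Fin n → ℕ) v →
  restrict U (λ v → ∑[ s < m ] h s v) v ≡ ∑[ s < m ] restrict U (h s) v
restrict-∑ {m} U h v with does (v ∈? U)
... | true  = refl
... | false = sym (sum-replicate-zero m)

module _ {n : ℕ} (d : Fin n → Fin n → ℕ) where

  sumOver≡∑ : ∀ U (g : Fin n → ℕ) → sumOver d U g ≡ ∑[ v < n ] restrict U g v
  sumOver≡∑ U g = sum-map-allFin (restrict U g)

  sumOver-∣tabulate∣ : ∀ U (e : Fin n → Fin n → Bool) →
    sumOver d U (λ v → ∣ tabulate (λ s → e s v) ∣) ≡ ∑[ s < n ] ∑[ v < n ] restrict U (λ v → 𝟙 (e s v)) v
  sumOver-∣tabulate∣ U e = begin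
    sumOver d U (λ v → ∣ tabulate (λ s → e s v) ∣)
      ≡⟨ sumOver≡∑ U _ ⟩
    ∑[ v < n ] restrict U (λ v → ∣ tabulate (λ s → e s v) ∣) v
      ≡⟨ sum-cong-≗ (λ v → cong (λ x → if does (v ∈? U) then x else 0) (∣tabulate∣≡∑ (λ s → e s v))) ⟩
    ∑[ v < n ] restrict U (λ v → ∑[ s < n ] 𝟙 (e s v)) v
      ≡⟨ sum-cong-≗ (restrict-∑ U (λ s v → 𝟙 (e s v))) ⟩
    ∑[ v < n ] ∑[ s < n ] restrict U (λ v → 𝟙 (e s v)) v
      ≡⟨ ∑-comm (λ v s → restrict U (λ v → 𝟙 (e s v)) v) ⟩
    ∑[ s < n ] ∑[ v < n ] restrict U (λ v → 𝟙 (e s v)) v ∎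
    where open ≡-Reasoning

  constant-distance⇒IsMidpoint : ∀ U w (c : ℤ) → (∀ u → u ∈ U → + d w u ≡ c) → IsMidpoint d U w
  constant-distance⇒IsMidpoint U w c ≡c u u∈U u' u'∈U = +-injective (trans (≡c u u∈U) (sym (≡c u' u'∈U)))

  module _ (f : Fin n → ℤ) where

    mismatch : Fin n → Fin n → Bool
    mismatch s v = not (does (+ d s v ≟ f s))

    noMismatchOn⇒IsMidpoint : ∀ U s → ∑[ v < n ] restrict U (λ v → 𝟙 (mismatch s v)) v ≡ 0 → IsMidpoint d U s
    noMismatchOn⇒IsMidpoint U s ∑≡0 = constant-distance⇒IsMidpoint U s (f s) λ v v∈U →
      𝟙-not-does≡0⇒ (+ d s v ≟ f s) (restrict≡0⇒ U mismatchAt (∑≡0⇒≡0 (restrict U mismatchAt) ∑≡0 v) v∈U)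
      where
      mismatchAt : Fin n → ℕ
      mismatchAt v = 𝟙 (mismatch s v)

-- The bound holds for an arbitrary d.
mainTheorem6 : (n : ℕ) (G : Graph n) → Connected G →
    (d : Fin n → Fin n → ℕ) → IsShortestPathDistance G d →
    (f : Fin n → ℤ) → (S U : Subset n) →
    sumOver d U (φ d f) ≥ ∣ S ─ M d U ∣
mainTheorem6 n _ _ d _ f S U = begin
  ∣ S ─ M d U ∣
    ≤⟨ ∣p─q∣≤∣∁q∣ S (M d U) ⟩
  ∣ ∁ (M d U) ∣
    ≡⟨ ∣∁tabulate∣≡∑ (λ s → does (isMidpoint? d U s)) ⟩
  ∑[ s < n ] 𝟙 (not (does (isMidpoint? d U s)))
    ≤⟨ ∑-mono-≤ (λ s → 𝟙-not-does≤ (isMidpoint? d U s) (noMismatchOn⇒IsMidpoint d f U s)) ⟩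
  ∑[ s < n ] ∑[ v < n ] restrict U (λ v → 𝟙 (mismatch d f s v)) v
    ≡⟨ sumOver-∣tabulate∣ d U (mismatch d f) ⟨
  sumOver d U (φ d f) ∎
  where open ≤-Reasoning
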